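{- For a positive integer $n$, let $\mu(n)$ be the union (as sets of cells) of the Ferrers diagrams of all partitions of $n$, and let $\tau(i)$ denote the number of positive divisors of $i$. Then $\mu(n)$ has exactly $\sum_{i=1}^n \tau(i)$ cells, and the number of corners of $\mu(n)$ (equivalently, the number of distinct row lengths of $\mu(n)$) equals $\lfloor\sqrt{4n+1}\rfloor-1$.
   Context: The Ferrers diagram of a partition $\lambda=(\lambda_1\ge\lambda_2\ge\cdots)$ is the set of cells $\{(i,j): 1\le j\le \lambda_i\}$ ($i$ = row index from the top, $j$ = column index). The union of Ferrers diagrams is again a Ferrers diagram (of some partition). A corner of a Ferrers diagram is a cell $(i,j)$ in the diagram such that neither $(i+1,j)$ nor $(i,j+1)$ is in the diagram. -}

module Defs where

open import Data.Nat using (ℕ; zero; suc; _+_; _*_; _∸_; _≤_; _<_; _≥_)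
open import Data.Nat.Divisibility using (_∣?_)
open import Data.Nat.ListAction using (sum)
open import Data.List using (List; []; _∷_; length; filter; map; upTo)
open import Data.List.Relation.Unary.All using (All)
open import Data.List.Relation.Unary.Linked using (Linked)
open import Data.List.Relation.Unary.Unique.Propositional using (Unique)
open import Data.List.Membership.Propositional using (_∈_)
open import Data.Product using (Σ; ∃; _×_; _,_)
open import Function.Bundles using (_⇔_)
open import Relation.Nullary using (¬_)
open import Relation.Binary.PropositionalEquality using (_≡_)

IsPartition : ℕ → List ℕ → Set
IsPartition n ps = (sum ps ≡ n) × All (λ x → 1 ≤ x) ps × Linked _≥_ ps

-- part ps i = λ_i (1-indexed); parts beyond the length (and index 0) are 0.
part : List ℕ → ℕ → ℕ
part []       _             = 0
part (x ∷ xs) zero          = 0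
part (x ∷ xs) (suc zero)    = x
part (x ∷ xs) (suc (suc i)) = part xs (suc i)

-- Cells are pairs (i , j) = (row , column), both 1-indexed.
Cell : Set
Cell = ℕ × ℕ

-- Ferrers diagram of ps: {(i,j) : 1 ≤ j ≤ λ_i}  (this forces i ≥ 1).
InFerrers : List ℕ → Cell → Set
InFerrers ps (i , j) = 1 ≤ j × j ≤ part ps i

InMu : ℕ → Cell → Set
InMu n c = Σ (List ℕ) λ ps → IsPartition n ps × InFerrers ps c

CornerMu : ℕ → Cell → Set
CornerMu n (i , j) = InMu n (i , j) × ¬ InMu n (suc i , j) × ¬ InMu n (i , suc j)

RowLengthMu : ℕ → ℕ → Set
RowLengthMu n ℓ = 1 ≤ ℓ × ∃ λ i → InMu n (i , ℓ) × ¬ InMu n (i , suc ℓ)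

HasCard : {A : Set} → (A → Set) → ℕ → Set
HasCard {A} P k = Σ (List A) λ xs → Unique xs × (∀ a → (a ∈ xs) ⇔ P a) × length xs ≡ k

τ : ℕ → ℕ
τ i = length (filter (_∣? i) (map suc (upTo i)))

sumτ : ℕ → ℕ
sumτ n = sum (map τ (map suc (upTo n)))

IsFloorSqrt : ℕ → ℕ → Set
IsFloorSqrt N m = m * m ≤ N × N < suc m * suc m

module Submission where

-- The union μ(n) of the Ferrers diagrams of all partitions of n is the
-- region under the hyperbola,  μ(n) = {(i , j) : i , j ≥ 1 , i·j ≤ n}:
-- the cell (i , j) lies in the diagram of a partition with λ_i ≥ j, which
-- forces i·j ≤ |λ| = n, and conversely the partition j^i 1^(n - ij)
-- contains it.  Everything else is counting in this region.
--
-- Passing from n to n+1 adds exactly the cells (d , (n+1)/d)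
--    with d a divisor of n+1, so μ(n) has τ(1) + … + τ(n) cells.
--  * Corners.  A corner (i , j) is a cell that ends both its row and its
--    column: j = ⌊n/i⌋ and i = ⌊n/j⌋.  Those with i ≤ j are (a , ⌊n/a⌋) for
--    a² ≤ n, those with j < i are (⌊n/b⌋ , b) for b(b+1) ≤ n.  With
--    m = ⌊√(4n+1)⌋ = k + 1 the two families have ⌈k/2⌉ and ⌊k/2⌋ members,
--    since (2a)² ≤ 4n+1 ⟺ a² ≤ n and (2b+1)² ≤ 4n+1 ⟺ b(b+1) ≤ n.
--  * Row lengths.  For every row length ℓ the lowest cell (⌊n/ℓ⌋ , ℓ) of
--    column ℓ is a corner, and a corner is determined by its column, so
--    row lengths and corners are equinumerous.

open import Defs
open import Data.Nat using (ℕ; suc; _+_; _*_; _∸_; _≤_)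
open import Data.Product using (_×_)
open import Data.Nat using (zero; _<_; _≥_; _≤?_; z≤n; s≤s; _/_; _%_; ⌊_/2⌋; ⌈_/2⌉)
open import Data.Nat.Properties
open import Data.Nat.DivMod using (m≡m%n+[m/n]*n; m%n<n; m/n*n≤m)
open import Data.Nat.Divisibility using (_∣_; divides; _∣?_; ∣⇒≤)
open import Data.Nat.ListAction using (sum)
open import Data.Nat.ListAction.Properties using (sum-++)
open import Data.Nat.Tactic.RingSolver using (solve-∀)
open import Data.List using (List; []; _∷_; _++_; map; upTo; filter; [_]; replicate)
open import Data.List.Properties using (map-++; upTo-∷ʳ; length-++; length-map; length-upTo)
open import Data.List.Relation.Unary.All using (All; []; _∷_)
import Data.List.Relation.Unary.All as All
import Data.List.Relation.Unary.All.Properties as All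
open import Data.List.Relation.Unary.Linked using (Linked; []; [-]; _∷_)
import Data.List.Relation.Unary.Linked as Linked
open import Data.List.Relation.Unary.Linked.Properties using (Linked⇒All)
open import Data.List.Relation.Unary.Unique.Propositional using (Unique)
open import Data.List.Relation.Unary.AllPairs using ([]; _∷_)
import Data.List.Relation.Unary.Unique.Propositional.Properties as Unique
open import Data.List.Membership.Propositional using (_∈_)
open import Data.List.Membership.Propositional.Properties
  using (∈-map⁺; ∈-map⁻; ∈-upTo⁺; ∈-upTo⁻; ∈-filter⁺; ∈-filter⁻; ∈-++⁺ˡ; ∈-++⁺ʳ; ∈-++⁻)
open import Data.Product using (∃; _,_; proj₁; proj₂)
open import Data.Sum using (_⊎_; inj₁; inj₂; [_,_]′)
open import Data.Empty using (⊥; ⊥-elim)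
open import Function.Base using (flip; _∘′_)
open import Function.Bundles using (_⇔_; mk⇔; Equivalence)
import Function.Properties.Equivalence as ⇔
open import Relation.Nullary using (¬_; yes; no; contradiction)
open import Relation.Binary.PropositionalEquality
  using (_≡_; refl; sym; trans; cong; cong₂; subst; module ≡-Reasoning)

hasCard-⇔ : {A : Set} {P Q : A → Set} {k : ℕ} →
            (∀ a → P a ⇔ Q a) → HasCard P k → HasCard Q k
hasCard-⇔ P⇔Q (xs , unique , xs⇔P , len) =
  xs , unique , (λ a → ⇔.trans (xs⇔P a) (P⇔Q a)) , len

hasCard-∅ : {A : Set} {P : A → Set} → (∀ a → ¬ P a) → HasCard P 0
hasCard-∅ empty = [] , [] , (λ a → mk⇔ (λ ()) (λ p → ⊥-elim (empty a p))) , refl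

hasCard-⊎ : {A : Set} {P Q : A → Set} {k l : ℕ} →
            HasCard P k → HasCard Q l → (∀ a → P a → Q a → ⊥) →
            HasCard (λ a → P a ⊎ Q a) (k + l)
hasCard-⊎ {P = P} {Q} (xs , uxs , xs⇔P , lxs) (ys , uys , ys⇔Q , lys) disjoint =
  xs ++ ys ,
  Unique.++⁺ uxs uys (λ (a∈xs , a∈ys) → disjoint _ (toP a∈xs) (toQ a∈ys)) ,
  (λ a → mk⇔ (λ a∈ → [ (λ a∈xs → inj₁ (toP a∈xs)) , (λ a∈ys → inj₂ (toQ a∈ys)) ]′ (∈-++⁻ xs a∈))
             [ (λ p → ∈-++⁺ˡ (Equivalence.from (xs⇔P a) p)) ,
               (λ q → ∈-++⁺ʳ xs (Equivalence.from (ys⇔Q a) q)) ]′) ,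
  trans (length-++ xs) (cong₂ _+_ lxs lys)
  where
  toP : ∀ {a} → a ∈ xs → P a
  toP {a} = Equivalence.to (xs⇔P a)
  toQ : ∀ {a} → a ∈ ys → Q a
  toQ {a} = Equivalence.to (ys⇔Q a)

map-unique : {A B : Set} {P : A → Set} (f : A → B) →
             (∀ {a b} → P a → P b → f a ≡ f b → a ≡ b) →
             {xs : List A} → All P xs → Unique xs → Unique (map f xs)
map-unique f injective [] [] = []
map-unique f injective (pa ∷ pas) (a∉as ∷ unique) =
  All.map⁺ (All.zipWith (λ (pb , a≢b) fa≡fb → a≢b (injective pa pb fa≡fb)) (pas , a∉as)) ∷
  map-unique f injective pas unique

hasCard-image : {A B : Set} {P : A → Set} {k : ℕ} (f : A → B) →
                (∀ {a b} → P a → P b → f a ≡ f b → a ≡ b) →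
                HasCard P k → HasCard (λ y → ∃ λ a → P a × f a ≡ y) k
hasCard-image f injective (xs , unique , xs⇔P , len) =
  map f xs ,
  map-unique f injective (All.tabulate (λ {a} → Equivalence.to (xs⇔P a))) unique ,
  (λ y → mk⇔ (λ y∈ → let (a , a∈ , y≡fa) = ∈-map⁻ f y∈ in a , Equivalence.to (xs⇔P a) a∈ , sym y≡fa)
             (λ { (a , pa , refl) → ∈-map⁺ f (Equivalence.from (xs⇔P a) pa) })) ,
  trans (length-map f xs) len

∈-interval : ∀ b d → (d ∈ map suc (upTo b)) ⇔ (1 ≤ d × d ≤ b)
∈-interval b d = mk⇔ to (λ { (s≤s z≤n , d≤b) → ∈-map⁺ suc (∈-upTo⁺ d≤b) })
  where
  to : d ∈ map suc (upTo b) → 1 ≤ d × d ≤ b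
  to d∈ with ∈-map⁻ suc d∈
  ... | x , x∈ , refl = s≤s z≤n , ∈-upTo⁻ x∈

hasCard-interval : ∀ b → HasCard (λ d → 1 ≤ d × d ≤ b) b
hasCard-interval b =
  map suc (upTo b) , Unique.map⁺ suc-injective (Unique.upTo⁺ b) , ∈-interval b ,
  trans (length-map suc (upTo b)) (length-upTo b)

hasCard-initial : (g : ℕ → ℕ) → (∀ {x y} → x ≤ y → g x ≤ g y) →
                  ∀ n b → g b ≤ n → n < g (suc b) →
                  HasCard (λ k → 1 ≤ k × g k ≤ n) b
hasCard-initial g mono n b gb≤n n<gb+1 =
  hasCard-⇔ (λ k → mk⇔ (λ (k≥1 , k≤b) → k≥1 , ≤-trans (mono k≤b) gb≤n)
                       (λ (k≥1 , gk≤n) → k≥1 , bounded k gk≤n))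
            (hasCard-interval b)
  where
  bounded : ∀ k → g k ≤ n → k ≤ b
  bounded k gk≤n with k ≤? b
  ... | yes k≤b = k≤b
  ... | no k≰b = contradiction (≤-trans (mono (≰⇒> k≰b)) gk≤n) (<⇒≱ n<gb+1)

-- quot n i = ⌊n / i⌋ for i ≥ 1 (the value at i = 0 is never used).
quot : ℕ → ℕ → ℕ
quot n zero    = 0
quot n (suc i) = n / suc i

quot-lower : ∀ n {i} → 1 ≤ i → i * quot n i ≤ n
quot-lower n {suc i} _ = subst (_≤ n) (*-comm (n / suc i) (suc i)) (m/n*n≤m n (suc i))

quot-upper : ∀ n {i} → 1 ≤ i → n < i * suc (quot n i)
quot-upper n {suc i} _ = begin-strict
  n                               ≡⟨ m≡m%n+[m/n]*n n (suc i) ⟩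
  n % suc i + (n / suc i) * suc i <⟨ +-monoˡ-< _ (m%n<n n (suc i)) ⟩
  suc i + (n / suc i) * suc i     ≡⟨ cong (suc i +_) (*-comm (n / suc i) (suc i)) ⟩
  suc i + suc i * (n / suc i)     ≡⟨ sym (*-suc (suc i) (n / suc i)) ⟩
  suc i * suc (n / suc i)         ∎
  where open ≤-Reasoning

quot-greatest : ∀ n {i j} → 1 ≤ i → i * j ≤ n → j ≤ quot n i
quot-greatest n {i} {j} i≥1 ij≤n with j ≤? quot n i
... | yes j≤q = j≤q
... | no j≰q = contradiction (≤-trans (*-monoʳ-≤ i (≰⇒> j≰q)) ij≤n) (<⇒≱ (quot-upper n i≥1))

quot-unique : ∀ n {i j} → 1 ≤ i → i * j ≤ n → n < i * suc j → j ≡ quot n i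
quot-unique n {i} {j} i≥1 ij≤n n<ij+i = ≤-antisym (quot-greatest n i≥1 ij≤n) q≤j
  where
  q≤j : quot n i ≤ j
  q≤j with quot n i ≤? j
  ... | yes q≤j = q≤j
  ... | no q≰j = contradiction (≤-trans (*-monoʳ-≤ i (≰⇒> q≰j)) (quot-lower n i≥1)) (<⇒≱ n<ij+i)

quot-exact : ∀ {n i j} → 1 ≤ i → i * j ≡ n → j ≡ quot n i
quot-exact {n} {i} {j} i≥1 ij≡n = quot-unique n i≥1 (≤-reflexive ij≡n) (begin-strict
  n           ≡⟨ sym ij≡n ⟩
  i * j       <⟨ m<n+m (i * j) i≥1 ⟩
  i + i * j   ≡⟨ sym (*-suc i j) ⟩
  i * suc j   ∎)
  where open ≤-Reasoning

-- The region under the hyperbola i·j = n, which turns out to be μ(n).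
Below : ℕ → Cell → Set
Below n (i , j) = 1 ≤ i × 1 ≤ j × i * j ≤ n

part-bounded : ∀ {x xs} → All (_≤ x) xs → ∀ i → part xs i ≤ x
part-bounded []           i             = z≤n
part-bounded (_ ∷ _)      zero          = z≤n
part-bounded (y≤x ∷ _)    (suc zero)    = y≤x
part-bounded (_ ∷ ys≤x)   (suc (suc i)) = part-bounded ys≤x (suc i)

-- In a weakly decreasing list the first i parts are all ≥ λ_i, so i·λ_i ≤ |λ|.
part-mul-≤-sum : ∀ ps → Linked _≥_ ps → ∀ i → i * part ps i ≤ sum ps
part-mul-≤-sum []       _         i             = ≤-reflexive (*-zeroʳ i)
part-mul-≤-sum (x ∷ xs) _         zero          = z≤n
part-mul-≤-sum (x ∷ xs) _         (suc zero)    = +-monoʳ-≤ x z≤n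
part-mul-≤-sum (x ∷ xs) decreasing (suc (suc i)) =
  +-mono-≤ (part-bounded (All.tail (Linked⇒All (flip ≤-trans) ≤-refl decreasing)) (suc i))
           (part-mul-≤-sum xs (Linked.tail decreasing) (suc i))

inMu⇒below : ∀ n c → InMu n c → Below n c
inMu⇒below n (zero , j) (ps , _ , j≥1 , j≤λ₀) =
  contradiction (≤-trans j≥1 (≤-trans j≤λ₀ (≤-reflexive (part-zero ps)))) λ ()
  where
  part-zero : ∀ ps → part ps 0 ≡ 0
  part-zero []      = refl
  part-zero (_ ∷ _) = refl
inMu⇒below n (suc i , j) (ps , (sum≡n , _ , decreasing) , j≥1 , j≤λᵢ) =
  s≤s z≤n , j≥1 ,
  ≤-trans (*-monoʳ-≤ (suc i) j≤λᵢ)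
          (≤-trans (part-mul-≤-sum ps decreasing (suc i)) (≤-reflexive sum≡n))

-- The partition j^i 1^r of ij + r, as a list: its sum, ordering and i-th part.
sum-replicate : ∀ r x → sum (replicate r x) ≡ r * x
sum-replicate zero    x = refl
sum-replicate (suc r) x = cong (x +_) (sum-replicate r x)

replicate-decreasing : ∀ r x → Linked _≥_ (replicate r x)
replicate-decreasing zero          x = []
replicate-decreasing (suc zero)    x = [-]
replicate-decreasing (suc (suc r)) x = ≤-refl ∷ replicate-decreasing (suc r) x

replicate-++-decreasing : ∀ i {x ys} → All (_≤ x) ys → Linked _≥_ ys →
                          Linked _≥_ (replicate i x ++ ys)
replicate-++-decreasing zero                   _          ys↓ = ys↓
replicate-++-decreasing (suc zero)    {ys = []}    _          _   = [-]
replicate-++-decreasing (suc zero)    {ys = _ ∷ _} (y≤x ∷ _)  ys↓ = y≤x ∷ ys↓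
replicate-++-decreasing (suc (suc i))              ys≤x       ys↓ =
  ≤-refl ∷ replicate-++-decreasing (suc i) ys≤x ys↓

part-replicate-++ : ∀ i x ys → part (replicate (suc i) x ++ ys) (suc i) ≡ x
part-replicate-++ zero    x ys = refl
part-replicate-++ (suc i) x ys = part-replicate-++ i x ys

-- Conversely the partition j^i 1^(n - ij) of n contains the cell (i , j).
below⇒inMu : ∀ n c → Below n c → InMu n c
below⇒inMu n (suc i , j) (_ , j≥1 , ij≤n) =
  replicate (suc i) j ++ replicate r 1 ,
  (sum≡n , All.++⁺ (All.replicate⁺ (suc i) j≥1) (All.replicate⁺ r ≤-refl) ,
   replicate-++-decreasing (suc i) (All.replicate⁺ r j≥1) (replicate-decreasing r 1)) ,
  j≥1 , ≤-reflexive (sym (part-replicate-++ i j (replicate r 1)))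
  where
  r : ℕ
  r = n ∸ suc i * j
  sum≡n : sum (replicate (suc i) j ++ replicate r 1) ≡ n
  sum≡n = begin
    sum (replicate (suc i) j ++ replicate r 1)     ≡⟨ sum-++ (replicate (suc i) j) (replicate r 1) ⟩
    sum (replicate (suc i) j) + sum (replicate r 1) ≡⟨ cong₂ _+_ (sum-replicate (suc i) j) (sum-replicate r 1) ⟩
    suc i * j + r * 1                               ≡⟨ cong (suc i * j +_) (*-identityʳ r) ⟩
    suc i * j + r                                   ≡⟨ m+[n∸m]≡n ij≤n ⟩
    n                                               ∎
    where open ≡-Reasoning

below⇔inMu : ∀ n c → Below n c ⇔ InMu n c
below⇔inMu n c = mk⇔ (below⇒inMu n c) (inMu⇒below n c)

OnHyperbola : ℕ → Cell → Set
OnHyperbola n (i , j) = 1 ≤ i × i * j ≡ n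

below-suc : ∀ n c → (Below n c ⊎ OnHyperbola (suc n) c) ⇔ Below (suc n) c
below-suc n (i , j) = mk⇔ to from
  where
  to : Below n (i , j) ⊎ OnHyperbola (suc n) (i , j) → Below (suc n) (i , j)
  to (inj₁ (i≥1 , j≥1 , ij≤n)) = i≥1 , j≥1 , m≤n⇒m≤1+n ij≤n
  to (inj₂ (i≥1 , ij≡n+1))     = i≥1 , j-positive j ij≡n+1 , ≤-reflexive ij≡n+1
    where
    j-positive : ∀ j → i * j ≡ suc n → 1 ≤ j
    j-positive zero    i0≡n+1 = contradiction (trans (sym (*-zeroʳ i)) i0≡n+1) 0≢1+n
    j-positive (suc j) _      = s≤s z≤n
  from : Below (suc n) (i , j) → Below n (i , j) ⊎ OnHyperbola (suc n) (i , j)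
  from (i≥1 , j≥1 , ij≤n+1) with m≤n⇒m<n∨m≡n ij≤n+1
  ... | inj₁ ij<n+1 = inj₁ (i≥1 , j≥1 , ≤-pred ij<n+1)
  ... | inj₂ ij≡n+1 = inj₂ (i≥1 , ij≡n+1)

Divisor : ℕ → ℕ → Set
Divisor n d = 1 ≤ d × d ∣ n

hasCard-divisor : ∀ n → HasCard (Divisor (suc n)) (τ (suc n))
hasCard-divisor n =
  filter (_∣? suc n) (map suc (upTo (suc n))) ,
  Unique.filter⁺ (_∣? suc n) (Unique.map⁺ suc-injective (Unique.upTo⁺ (suc n))) ,
  (λ d → mk⇔ (λ d∈ → let (d∈interval , d∣n) = ∈-filter⁻ (_∣? suc n) d∈
                     in proj₁ (Equivalence.to (∈-interval (suc n) d) d∈interval) , d∣n)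
             (λ (d≥1 , d∣n) → ∈-filter⁺ (_∣? suc n)
                                 (Equivalence.from (∈-interval (suc n) d) (d≥1 , ∣⇒≤ d∣n)) d∣n)) ,
  refl

divisor-cell⇔onHyperbola : ∀ n c → (∃ λ d → Divisor n d × (d , quot n d) ≡ c) ⇔ OnHyperbola n c
divisor-cell⇔onHyperbola n c = mk⇔ to (from c)
  where
  to : (∃ λ d → Divisor n d × (d , quot n d) ≡ c) → OnHyperbola n c
  to (d , (d≥1 , divides q n≡qd) , refl) = d≥1 , (begin
    d * quot n d  ≡⟨ cong (d *_) (sym (quot-exact d≥1 (trans (*-comm d q) (sym n≡qd)))) ⟩
    d * q         ≡⟨ *-comm d q ⟩
    q * d         ≡⟨ sym n≡qd ⟩
    n             ∎)
    where open ≡-Reasoning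
  from : ∀ c → OnHyperbola n c → ∃ λ d → Divisor n d × (d , quot n d) ≡ c
  from (i , j) (i≥1 , ij≡n) =
    i , (i≥1 , divides j (trans (sym ij≡n) (*-comm i j))) , cong (i ,_) (sym (quot-exact i≥1 ij≡n))

hasCard-onHyperbola : ∀ n → HasCard (OnHyperbola (suc n)) (τ (suc n))
hasCard-onHyperbola n =
  hasCard-⇔ (divisor-cell⇔onHyperbola (suc n))
            (hasCard-image (λ d → d , quot (suc n) d) (λ _ _ → cong proj₁) (hasCard-divisor n))

sumτ-suc : ∀ n → sumτ (suc n) ≡ sumτ n + τ (suc n)
sumτ-suc n = begin
  sum (map τ (map suc (upTo (suc n))))              ≡⟨ cong (λ l → sum (map τ (map suc l))) (sym (upTo-∷ʳ n)) ⟩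
  sum (map τ (map suc (upTo n ++ [ n ])))           ≡⟨ cong (λ l → sum (map τ l)) (map-++ suc (upTo n) [ n ]) ⟩
  sum (map τ (map suc (upTo n) ++ [ suc n ]))       ≡⟨ cong sum (map-++ τ (map suc (upTo n)) [ suc n ]) ⟩
  sum (map τ (map suc (upTo n)) ++ [ τ (suc n) ])   ≡⟨ sum-++ (map τ (map suc (upTo n))) [ τ (suc n) ] ⟩
  sumτ n + (τ (suc n) + 0)                          ≡⟨ cong (sumτ n +_) (+-identityʳ _) ⟩
  sumτ n + τ (suc n)                                ∎
  where open ≡-Reasoning

hasCard-below : ∀ n → HasCard (Below n) (sumτ n)
hasCard-below zero    = hasCard-∅ λ { (i , j) (s≤s _ , s≤s _ , ()) }
hasCard-below (suc n) =
  subst (HasCard (Below (suc n))) (sym (sumτ-suc n))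
        (hasCard-⇔ (below-suc n) (hasCard-⊎ (hasCard-below n) (hasCard-onHyperbola n) disjoint))
  where
  disjoint : ∀ c → Below n c → OnHyperbola (suc n) c → ⊥
  disjoint (i , j) (_ , _ , ij≤n) (_ , ij≡n+1) = 1+n≰n (subst (_≤ n) ij≡n+1 ij≤n)

-- Corners and row lengths of an arbitrary set of cells; for D = InMu n these
-- are exactly CornerMu n and RowLengthMu n.
CornerOf : (Cell → Set) → Cell → Set
CornerOf D (i , j) = D (i , j) × ¬ D (suc i , j) × ¬ D (i , suc j)

RowLengthOf : (Cell → Set) → ℕ → Set
RowLengthOf D ℓ = 1 ≤ ℓ × ∃ λ i → D (i , ℓ) × ¬ D (i , suc ℓ)

cornerOf-⇔ : {D E : Cell → Set} → (∀ c → D c ⇔ E c) → ∀ c → CornerOf D c ⇔ CornerOf E c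
cornerOf-⇔ {D} {E} D⇔E (i , j) = mk⇔
  (λ (d , ¬down , ¬right) → to d , ¬down ∘′ from , ¬right ∘′ from)
  (λ (e , ¬down , ¬right) → from e , ¬down ∘′ to , ¬right ∘′ to)
  where
  to : ∀ {c} → D c → E c
  to {c} = Equivalence.to (D⇔E c)
  from : ∀ {c} → E c → D c
  from {c} = Equivalence.from (D⇔E c)

rowLengthOf-⇔ : {D E : Cell → Set} → (∀ c → D c ⇔ E c) → ∀ ℓ → RowLengthOf D ℓ ⇔ RowLengthOf E ℓ
rowLengthOf-⇔ {D} {E} D⇔E ℓ = mk⇔
  (λ (ℓ≥1 , i , d , ¬right) → ℓ≥1 , i , to d , ¬right ∘′ from)
  (λ (ℓ≥1 , i , e , ¬right) → ℓ≥1 , i , from e , ¬right ∘′ to)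
  where
  to : ∀ {c} → D c → E c
  to {c} = Equivalence.to (D⇔E c)
  from : ∀ {c} → E c → D c
  from {c} = Equivalence.from (D⇔E c)

Corner : ℕ → Cell → Set
Corner n = CornerOf (Below n)

outside-above : ∀ {n i j} → 1 ≤ i → 1 ≤ j → ¬ Below n (i , j) → n < i * j
outside-above i≥1 j≥1 outside = ≰⇒> (λ ij≤n → outside (i≥1 , j≥1 , ij≤n))

above-outside : ∀ {n i j} → n < i * j → ¬ Below n (i , j)
above-outside n<ij (_ , _ , ij≤n) = <⇒≱ n<ij ij≤n

below-transpose : ∀ {n i j} → Below n (i , j) → Below n (j , i)
below-transpose {n} {i} {j} (i≥1 , j≥1 , ij≤n) = j≥1 , i≥1 , subst (_≤ n) (*-comm i j) ij≤n

corner-transpose : ∀ {n i j} → Corner n (i , j) → Corner n (j , i)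
corner-transpose (cell , ¬down , ¬right) =
  below-transpose cell , ¬right ∘′ below-transpose , ¬down ∘′ below-transpose

corner-row : ∀ {n i j} → Corner n (i , j) → j ≡ quot n i
corner-row {n} ((i≥1 , j≥1 , ij≤n) , _ , ¬right) =
  quot-unique n i≥1 ij≤n (outside-above i≥1 (s≤s z≤n) ¬right)

corner-column : ∀ {n i j} → Corner n (i , j) → i ≡ quot n j
corner-column corner = corner-row (corner-transpose corner)

row-end-corner : ∀ {n a} → 1 ≤ a → a ≤ quot n a → Corner n (a , quot n a)
row-end-corner {n} {a} a≥1 a≤q =
  (a≥1 , ≤-trans a≥1 a≤q , quot-lower n a≥1) ,
  above-outside (begin-strict
    n              <⟨ quot-upper n a≥1 ⟩
    a * suc q      ≡⟨ *-suc a q ⟩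
    a + a * q      ≤⟨ +-monoˡ-≤ (a * q) a≤q ⟩
    q + a * q      ∎) ,
  above-outside (quot-upper n a≥1)
  where
  q : ℕ
  q = quot n a
  open ≤-Reasoning

-- Corners on or above the diagonal are indexed by a with a² ≤ n, those
-- below it by b with b(b+1) ≤ n.
SquareAtMost : ℕ → ℕ → Set
SquareAtMost n a = 1 ≤ a × a * a ≤ n

PronicAtMost : ℕ → ℕ → Set
PronicAtMost n b = 1 ≤ b × b * suc b ≤ n

CornerFamilies : ℕ → Cell → Set
CornerFamilies n c =
  (∃ λ a → SquareAtMost n a × (a , quot n a) ≡ c) ⊎ (∃ λ b → PronicAtMost n b × (quot n b , b) ≡ c)

families⇒corner : ∀ n c → CornerFamilies n c → Corner n c
families⇒corner n c (inj₁ (a , (a≥1 , aa≤n) , refl)) =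
  row-end-corner a≥1 (quot-greatest n a≥1 aa≤n)
families⇒corner n c (inj₂ (b , (b≥1 , bb+b≤n) , refl)) =
  corner-transpose (row-end-corner b≥1 (≤-trans (n≤1+n b) (quot-greatest n b≥1 bb+b≤n)))

-- ... and every corner (i , j) is one: take a = i if i ≤ j, and b = j otherwise.
corner⇒families : ∀ n c → Corner n c → CornerFamilies n c
corner⇒families n (i , j) corner@((i≥1 , j≥1 , ij≤n) , _) with i ≤? j
... | yes i≤j = inj₁ (i , (i≥1 , ≤-trans (*-monoʳ-≤ i i≤j) ij≤n) ,
                       cong (i ,_) (sym (corner-row corner)))
... | no i≰j  = inj₂ (j , (j≥1 , ≤-trans (*-monoʳ-≤ j (≰⇒> i≰j)) ji≤n) ,
                       cong (_, j) (sym (corner-column corner)))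
  where
  ji≤n : j * i ≤ n
  ji≤n = subst (_≤ n) (*-comm i j) ij≤n

-- No corner is in both families: (a , ⌊n/a⌋) = (⌊n/b⌋ , b) would give
-- b + 1 ≤ ⌊n/b⌋ = a ≤ ⌊n/a⌋ = b.
families-disjoint : ∀ n c → (∃ λ a → SquareAtMost n a × (a , quot n a) ≡ c) →
                    (∃ λ b → PronicAtMost n b × (quot n b , b) ≡ c) → ⊥
families-disjoint n c (a , (a≥1 , aa≤n) , refl) (b , (b≥1 , bb+b≤n) , same) =
  1+n≰n (≤-trans (subst (suc b ≤_) (cong proj₁ same) (quot-greatest n b≥1 bb+b≤n))
                 (subst (a ≤_) (sym (cong proj₂ same)) (quot-greatest n a≥1 aa≤n)))

hasCard-corner : ∀ n {s t} → HasCard (SquareAtMost n) s → HasCard (PronicAtMost n) t →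
                 HasCard (Corner n) (s + t)
hasCard-corner n squares pronics =
  hasCard-⇔ (λ c → mk⇔ (families⇒corner n c) (corner⇒families n c))
    (hasCard-⊎ (hasCard-image (λ a → a , quot n a) (λ _ _ → cong proj₁) squares)
               (hasCard-image (λ b → quot n b , b) (λ _ _ → cong proj₂) pronics)
               (families-disjoint n))

corner-column⇔rowLength : ∀ n ℓ → (∃ λ c → Corner n c × proj₂ c ≡ ℓ) ⇔ RowLengthOf (Below n) ℓ
corner-column⇔rowLength n ℓ = mk⇔ to from
  where
  to : (∃ λ c → Corner n c × proj₂ c ≡ ℓ) → RowLengthOf (Below n) ℓ
  to ((i , j) , (cell@(_ , j≥1 , _) , _ , ¬right) , refl) = j≥1 , i , cell , ¬right
  from : RowLengthOf (Below n) ℓ → ∃ λ c → Corner n c × proj₂ c ≡ ℓ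
  from (ℓ≥1 , i , (i≥1 , _ , iℓ≤n) , ¬right) =
    (q , ℓ) ,
    corner-transpose ((ℓ≥1 , ≤-trans i≥1 i≤q , quot-lower n ℓ≥1) ,
                      above-outside (<-≤-trans n<i[ℓ+1] (*-monoʳ-≤ (suc ℓ) i≤q)) ,
                      above-outside (quot-upper n ℓ≥1)) ,
    refl
    where
    q : ℕ
    q = quot n ℓ
    i≤q : i ≤ q
    i≤q = quot-greatest n ℓ≥1 (subst (_≤ n) (*-comm i ℓ) iℓ≤n)
    n<i[ℓ+1] : n < suc ℓ * i
    n<i[ℓ+1] = subst (n <_) (*-comm i (suc ℓ)) (outside-above i≥1 (s≤s z≤n) ¬right)

-- Hence row lengths are as many as corners: a corner is determined by its column.
hasCard-rowLength : ∀ n {k} → HasCard (Corner n) k → HasCard (RowLengthOf (Below n)) k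
hasCard-rowLength n corners =
  hasCard-⇔ (corner-column⇔rowLength n)
            (hasCard-image proj₂ same-column corners)
  where
  same-column : ∀ {c d} → Corner n c → Corner n d → proj₂ c ≡ proj₂ d → c ≡ d
  same-column {i , j} {i′ , .j} corner corner′ refl =
    cong (_, j) (trans (corner-column corner) (sym (corner-column corner′)))

quadruple-cancel : ∀ x y → 4 * x ≤ 4 * y + 1 → x ≤ y
quadruple-cancel x y 4x≤4y+1 with x ≤? y
... | yes x≤y = x≤y
... | no x≰y  = contradiction (≤-trans (*-monoʳ-≤ 4 (≰⇒> x≰y)) 4x≤4y+1) (<⇒≱ 4y+1<4[y+1])
  where
  4y+1<4[y+1] : 4 * y + 1 < 4 * suc y
  4y+1<4[y+1] rewrite *-suc 4 y | +-comm (4 * y) 1 = s≤s (s≤s (m≤n+m (4 * y) 2))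

even-square : ∀ a → (a + a) * (a + a) ≡ 4 * (a * a)
even-square = solve-∀

odd-square : ∀ b → suc (b + b) * suc (b + b) ≡ 4 * (b * suc b) + 1
odd-square = solve-∀

even-square-≤ : ∀ a n → (a + a) * (a + a) ≤ 4 * n + 1 → a * a ≤ n
even-square-≤ a n le = quadruple-cancel (a * a) n (subst (_≤ 4 * n + 1) (even-square a) le)

even-square-> : ∀ a n → 4 * n + 1 < (a + a) * (a + a) → n < a * a
even-square-> a n gt = ≰⇒> λ aa≤n → <⇒≱ gt (begin
  (a + a) * (a + a)  ≡⟨ even-square a ⟩
  4 * (a * a)        ≤⟨ *-monoʳ-≤ 4 aa≤n ⟩
  4 * n              ≤⟨ m≤m+n (4 * n) 1 ⟩
  4 * n + 1          ∎)
  where open ≤-Reasoning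

odd-square-≤ : ∀ b n → suc (b + b) * suc (b + b) ≤ 4 * n + 1 → b * suc b ≤ n
odd-square-≤ b n le =
  *-cancelˡ-≤ 4 (+-cancelʳ-≤ 1 _ _ (subst (_≤ 4 * n + 1) (odd-square b) le))

odd-square-> : ∀ b n → 4 * n + 1 < suc (b + b) * suc (b + b) → n < b * suc b
odd-square-> b n gt =
  *-cancelˡ-< 4 n (b * suc b) (+-cancelʳ-< 1 (4 * n) _ (subst (4 * n + 1 <_) (odd-square b) gt))

floorSqrt-below : ∀ {N m c} → IsFloorSqrt N m → c ≤ m → c * c ≤ N
floorSqrt-below (mm≤N , _) c≤m = ≤-trans (*-mono-≤ c≤m c≤m) mm≤N

floorSqrt-above : ∀ {N m c} → IsFloorSqrt N m → m < c → N < c * c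
floorSqrt-above (_ , N<[m+1]²) m<c = <-≤-trans N<[m+1]² (*-mono-≤ m<c m<c)

half-bounds : ∀ k → ⌊ k /2⌋ + ⌊ k /2⌋ ≤ k × k ≤ suc (⌊ k /2⌋ + ⌊ k /2⌋)
half-bounds zero          = z≤n , z≤n
half-bounds (suc zero)    = z≤n , s≤s z≤n
half-bounds (suc (suc k)) =
  s≤s (subst (_≤ suc k) (sym (+-suc h h)) (s≤s lower)) ,
  s≤s (s≤s (subst (k ≤_) (sym (+-suc h h)) upper))
  where
  h : ℕ
  h = ⌊ k /2⌋
  lower : h + h ≤ k
  lower = proj₁ (half-bounds k)
  upper : k ≤ suc (h + h)
  upper = proj₂ (half-bounds k)

floorSqrt-square : ∀ n k → IsFloorSqrt (4 * n + 1) (suc k) →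
                   ⌈ k /2⌉ * ⌈ k /2⌉ ≤ n × n < suc ⌈ k /2⌉ * suc ⌈ k /2⌉
floorSqrt-square n k root =
  even-square-≤ a n (floorSqrt-below root (proj₁ (half-bounds (suc k)))) ,
  even-square-> (suc a) n (floorSqrt-above root
    (subst (suc k <_) (sym (+-suc (suc a) a)) (s≤s (proj₂ (half-bounds (suc k))))))
  where
  a : ℕ
  a = ⌈ k /2⌉

floorSqrt-pronic : ∀ n k → IsFloorSqrt (4 * n + 1) (suc k) →
                   ⌊ k /2⌋ * suc ⌊ k /2⌋ ≤ n × n < suc ⌊ k /2⌋ * suc (suc ⌊ k /2⌋)
floorSqrt-pronic n k root =
  odd-square-≤ b n (floorSqrt-below root (s≤s (proj₁ (half-bounds k)))) ,
  odd-square-> (suc b) n (floorSqrt-above root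
    (s≤s (s≤s (subst (k ≤_) (sym (+-suc b b)) (proj₂ (half-bounds k))))))
  where
  b : ℕ
  b = ⌊ k /2⌋

-- μ(n) has exactly k corners when ⌊√(4n+1)⌋ = k + 1: the two corner
-- families have ⌈k/2⌉ and ⌊k/2⌋ members.
hasCard-corner-floorSqrt : ∀ n k → IsFloorSqrt (4 * n + 1) (suc k) → HasCard (Corner n) k
hasCard-corner-floorSqrt n k root =
  subst (HasCard (Corner n)) (trans (+-comm ⌈ k /2⌉ ⌊ k /2⌋) (⌊n/2⌋+⌈n/2⌉≡n k))
        (hasCard-corner n squares pronics)
  where
  squares : HasCard (SquareAtMost n) ⌈ k /2⌉
  squares = let (lo , hi) = floorSqrt-square n k root
            in hasCard-initial (λ a → a * a) (λ a≤b → *-mono-≤ a≤b a≤b) n _ lo hi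
  pronics : HasCard (PronicAtMost n) ⌊ k /2⌋
  pronics = let (lo , hi) = floorSqrt-pronic n k root
            in hasCard-initial (λ b → b * suc b) (λ a≤b → *-mono-≤ a≤b (s≤s a≤b)) n _ lo hi

-- Transport the counts from the hyperbola region to μ(n); the case ⌊√(4n+1)⌋ = 0
-- is impossible.
proposition3p4 : (n : ℕ) → 1 ≤ n →
    HasCard (InMu n) (sumτ n) ×
    ((m : ℕ) → IsFloorSqrt (4 * n + 1) m →
      HasCard (CornerMu n) (m ∸ 1) × HasCard (RowLengthMu n) (m ∸ 1))
proposition3p4 n _ = hasCard-⇔ (below⇔inMu n) (hasCard-below n) , cornersAndRows
  where
  cornersAndRows : (m : ℕ) → IsFloorSqrt (4 * n + 1) m →
                   HasCard (CornerMu n) (m ∸ 1) × HasCard (RowLengthMu n) (m ∸ 1)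
  cornersAndRows zero    (_ , 4n+1<1) = ⊥-elim (<⇒≱ 4n+1<1 (m≤n+m 1 (4 * n)))
  cornersAndRows (suc k) root =
    hasCard-⇔ (cornerOf-⇔ (below⇔inMu n)) corners ,
    hasCard-⇔ (rowLengthOf-⇔ (below⇔inMu n)) (hasCard-rowLength n corners)
    where
    corners : HasCard (Corner n) k
    corners = hasCard-corner-floorSqrt n k root
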